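{- Let $\mathsf{L}\in\{\mathbf{PD},\mathsf{InqL},\mathbf{PT}\}$ and let $\phi$ be a consistent formula of $\mathsf{L}$ whose variables are among $p_1,\dots,p_n$. The following are equivalent: (i) $\phi\vdash_{\mathsf{L}}\Theta_X$ and $\Theta_X\vdash_{\mathsf{L}}\phi$ for some nonempty team $X$ on $\{p_1,\dots,p_n\}$; (ii) $\phi$ is flat; (iii) $\phi$ is $\mathcal{F}$-projective in $\mathsf{L}$, where $\mathcal{F}$ is the class of flat substitutions.
   Context: A valuation is a function $v:\mathrm{Prop}\to\{0,1\}$; a team is a set of valuations; a team on $V$ is a set of functions $V\to\{0,1\}$. Formulas of $\mathbf{PT}$: $\phi::=p\mid\bot\mid\top\mid {=}(\phi,\dots,\phi,\phi)\mid\neg\phi\mid\phi\wedge\phi\mid\phi\otimes\phi\mid\phi\vee\phi\mid\phi\to\phi$. Team semantics: $X\models p$ iff $v(p)=1$ for all $v\in X$; $X\models\bot$ iff $X=\emptyset$; $X\models\top$ always; $X\models\phi\wedge\psi$ iff both; $X\models\phi\otimes\psi$ iff $X=Y\cup Z$ for some $Y,Z\subseteq X$ with $Y\models\phi$, $Z\models\psi$; $X\models\phi\vee\psi$ iff $X\models\phi$ or $X\models\psi$; $X\models\phi\to\psi$ iff every $Y\subseteq X$ with $Y\models\phi$ satisfies $Y\models\psi$; $X\models\neg\phi$ iff $\{v\}\not\models\phi$ for all $v\in X$; $X\models{=}(\phi_1,\dots,\phi_n,\psi)$ iff $X\models\bigwedge_i(\phi_i\vee\neg\phi_i)\to(\psi\vee\neg\psi)$.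 A formula is flat if for every team $X$: $X\models\phi$ iff $\{v\}\models\phi$ for all $v\in X$. Formulas of $\mathbf{PD}$: $\phi::=p\mid\bot\mid\top\mid{=}(\alpha_1,\dots,\alpha_k,\beta)\mid\neg\phi\mid\phi\wedge\phi\mid\phi\otimes\phi$ with $\alpha_i,\beta$ flat $\mathbf{PD}$-formulas, same semantics. Formulas of $\mathsf{InqL}$: built from $p,\bot,\top$ by $\wedge,\vee,\to$, same semantics. $\Gamma\vdash_{\mathsf{L}}\phi$ iff all formulas are in the language of $\mathsf{L}$ and every team satisfying all of $\Gamma$ satisfies $\phi$; $\phi$ is consistent if some nonempty team satisfies it. For a nonempty team $X$ on $\{p_1,\dots,p_n\}$, with $p^1:=p$, $p^0:=\neg p$: $\Theta_X:=\bigotimes_{v\in X}(p_1^{v(p_1)}\wedge\dots\wedge p_n^{v(p_n)})$ when $\mathsf{L}=\mathbf{PD}$, and $\Theta_X:=\neg\neg\bigvee_{v\in X}(p_1^{v(p_1)}\wedge\dots\wedge p_n^{v(p_n)})$ when $\mathsf{L}\in\{\mathsf{InqL},\mathbf{PT}\}$. A substitution of $\mathsf{L}$ is a map on formulas of $\mathsf{L}$ commuting with all connectives and atoms; flat if each $\sigma(p)$ is flat. $\phi$ is $\mathcal{F}$-projective in $\mathsf{L}$ if there is a flat substitution $\sigma$ with $\vdash_{\mathsf{L}}\sigma(\phi)$ and, for every variable $p$, $\phi,\sigma(p)\vdash_{\mathsf{L}}p$ and $\phi,p\vdash_{\mathsf{L}}\sigma(p)$. -}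

module Defs where

open import Level using (Level; 0ℓ; Lift) renaming (suc to lsuc)
open import Data.Nat using (ℕ; _<_)
open import Data.Bool using (Bool; true; false)
open import Data.Fin using (Fin; toℕ)
open import Data.List using (List; []; _∷_)
open import Data.List.NonEmpty using (List⁺; _∷_)
import Data.List.NonEmpty as L⁺
open import Data.List.Relation.Unary.All using (All)
open import Data.Product using (Σ; _×_; _,_)
open import Data.Sum using (_⊎_)
open import Data.Unit using (⊤)
open import Data.Empty using (⊥)
open import Relation.Nullary using (¬_)

-- Propositional variables are natural numbers: p_i is 'atom i'.
Valuation : Set
Valuation = ℕ → Bool

Team : Set₁
Team = Valuation → Set

_⊆_ : Team → Team → Set
Y ⊆ X = ∀ v → Y v → X v

｛_｝ : Valuation → Team
｛ v ｝ = λ w → ∀ i → w i ≡' v i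
  where
  open import Relation.Binary.PropositionalEquality renaming (_≡_ to _≡'_)

NonEmpty : Team → Set
NonEmpty X = Σ Valuation X

-- Formulas of PT (the largest language; PD and InqL are sublanguages)

infixr 6 _∧'_
infixr 5 _⊗_ _∨'_
infixr 4 _⇒_

data Fm : Set where
  atom : ℕ → Fm
  ⊥'   : Fm
  ⊤'   : Fm
  dep  : List Fm → Fm → Fm        -- =(φ1,…,φk,ψ)  is  dep (φ1 ∷ … ∷ φk ∷ []) ψ
  ¬'   : Fm → Fm
  _∧'_ : Fm → Fm → Fm
  _⊗_  : Fm → Fm → Fm
  _∨'_ : Fm → Fm → Fm
  _⇒_  : Fm → Fm → Fm

open import Relation.Binary.PropositionalEquality using (_≡_)

mutual
  infix 3 _⊨_
  _⊨_ : Team → Fm → Set₁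
  X ⊨ atom p  = Lift (lsuc 0ℓ) (∀ v → X v → v p ≡ true)
  X ⊨ ⊥'      = Lift (lsuc 0ℓ) (∀ v → ¬ X v)
  X ⊨ ⊤'      = Lift (lsuc 0ℓ) ⊤
  X ⊨ dep φs ψ = ∀ Y → Y ⊆ X → DepAnte Y φs → (Y ⊨ ψ) ⊎ NegSat Y ψ
  X ⊨ ¬' φ    = NegSat X φ
  X ⊨ φ ∧' ψ  = (X ⊨ φ) × (X ⊨ ψ)
  X ⊨ φ ⊗ ψ   = Σ Team λ Y → Σ Team λ Z →
                  Y ⊆ X × Z ⊆ X × (∀ v → X v → Y v ⊎ Z v) × (Y ⊨ φ) × (Z ⊨ ψ)
  X ⊨ φ ∨' ψ  = (X ⊨ φ) ⊎ (X ⊨ ψ)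
  X ⊨ φ ⇒ ψ   = ∀ Y → Y ⊆ X → Y ⊨ φ → Y ⊨ ψ

  NegSat : Team → Fm → Set₁
  NegSat X φ = ∀ v → X v → ¬ (｛ v ｝ ⊨ φ)

  -- Y ⊨ ⋀_i (φ_i ∨ ¬φ_i)   (empty conjunction = ⊤)
  DepAnte : Team → List Fm → Set₁
  DepAnte Y []       = Lift (lsuc 0ℓ) ⊤
  DepAnte Y (φ ∷ φs) = ((Y ⊨ φ) ⊎ NegSat Y φ) × DepAnte Y φs

Flat : Fm → Set₁
Flat φ = ∀ X → ((X ⊨ φ) → (∀ v → X v → ｛ v ｝ ⊨ φ))
             × ((∀ v → X v → ｛ v ｝ ⊨ φ) → (X ⊨ φ))

Consistent : Fm → Set₁
Consistent φ = Σ Team λ X → NonEmpty X × (X ⊨ φ)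

data Logic : Set where
  PD InqL PT : Logic

mutual
  data InPD : Fm → Set₁ where
    atom : ∀ p → InPD (atom p)
    bot  : InPD ⊥'
    top  : InPD ⊤'
    dep  : ∀ {αs β} → InPDFlats αs → InPD β → Flat β → InPD (dep αs β)
    neg  : ∀ {φ} → InPD φ → InPD (¬' φ)
    and  : ∀ {φ ψ} → InPD φ → InPD ψ → InPD (φ ∧' ψ)
    tens : ∀ {φ ψ} → InPD φ → InPD ψ → InPD (φ ⊗ ψ)

  data InPDFlats : List Fm → Set₁ where
    []  : InPDFlats []
    _∷_ : ∀ {α αs} → InPD α × Flat α → InPDFlats αs → InPDFlats (α ∷ αs)

data InInqL : Fm → Set where
  atom : ∀ p → InInqL (atom p)
  bot  : InInqL ⊥'
  top  : InInqL ⊤'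
  and  : ∀ {φ ψ} → InInqL φ → InInqL ψ → InInqL (φ ∧' ψ)
  or   : ∀ {φ ψ} → InInqL φ → InInqL ψ → InInqL (φ ∨' ψ)
  imp  : ∀ {φ ψ} → InInqL φ → InInqL ψ → InInqL (φ ⇒ ψ)

InL : Logic → Fm → Set₁
InL PD   φ = InPD φ
InL InqL φ = Lift (lsuc 0ℓ) (InInqL φ)
InL PT   φ = Lift (lsuc 0ℓ) ⊤

_⊢⟨_⟩_ : List Fm → Logic → Fm → Set₁
Γ ⊢⟨ L ⟩ φ = All (InL L) Γ × InL L φ
           × (∀ (X : Team) → All (λ γ → X ⊨ γ) Γ → X ⊨ φ)

mutual
  VarsBelow : ℕ → Fm → Set
  VarsBelow n (atom p)   = p < n
  VarsBelow n ⊥'         = ⊤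
  VarsBelow n ⊤'         = ⊤
  VarsBelow n (dep φs ψ) = VarsBelowAll n φs × VarsBelow n ψ
  VarsBelow n (¬' φ)     = VarsBelow n φ
  VarsBelow n (φ ∧' ψ)   = VarsBelow n φ × VarsBelow n ψ
  VarsBelow n (φ ⊗ ψ)    = VarsBelow n φ × VarsBelow n ψ
  VarsBelow n (φ ∨' ψ)   = VarsBelow n φ × VarsBelow n ψ
  VarsBelow n (φ ⇒ ψ)    = VarsBelow n φ × VarsBelow n ψ

  VarsBelowAll : ℕ → List Fm → Set
  VarsBelowAll n []       = ⊤
  VarsBelowAll n (φ ∷ φs) = VarsBelow n φ × VarsBelowAll n φs

mutual
  subst : (ℕ → Fm) → Fm → Fm
  subst σ (atom p)   = σ p
  subst σ ⊥'         = ⊥'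
  subst σ ⊤'         = ⊤'
  subst σ (dep φs ψ) = dep (substs σ φs) (subst σ ψ)
  subst σ (¬' φ)     = ¬' (subst σ φ)
  subst σ (φ ∧' ψ)   = subst σ φ ∧' subst σ ψ
  subst σ (φ ⊗ ψ)    = subst σ φ ⊗ subst σ ψ
  subst σ (φ ∨' ψ)   = subst σ φ ∨' subst σ ψ
  subst σ (φ ⇒ ψ)    = subst σ φ ⇒ subst σ ψ

  substs : (ℕ → Fm) → List Fm → List Fm
  substs σ []       = []
  substs σ (φ ∷ φs) = subst σ φ ∷ substs σ φs

FProjective : Logic → Fm → Set₁
FProjective L φ =
  Σ (ℕ → Fm) λ σ →
      (∀ p → InL L (σ p) × Flat (σ p))
    × ([] ⊢⟨ L ⟩ subst σ φ)
    × (∀ p → ((φ ∷ σ p ∷ []) ⊢⟨ L ⟩ atom p) × ((φ ∷ atom p ∷ []) ⊢⟨ L ⟩ σ p))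

negL : Logic → Fm → Fm
negL InqL φ = φ ⇒ ⊥'
negL PD   φ = ¬' φ
negL PT   φ = ¬' φ

lit : Logic → ℕ → Bool → Fm
lit L p true  = atom p
lit L p false = negL L (atom p)

bigAnd : List Fm → Fm
bigAnd []           = ⊤'
bigAnd (φ ∷ [])     = φ
bigAnd (φ ∷ ψ ∷ φs) = φ ∧' bigAnd (ψ ∷ φs)

bigOpFrom : (Fm → Fm → Fm) → Fm → List Fm → Fm
bigOpFrom _∙_ φ []       = φ
bigOpFrom _∙_ φ (ψ ∷ φs) = φ ∙ bigOpFrom _∙_ ψ φs

bigOp⁺ : (Fm → Fm → Fm) → List⁺ Fm → Fm
bigOp⁺ _∙_ (φ ∷ φs) = bigOpFrom _∙_ φ φs

charFm : Logic → (n : ℕ) → (Fin n → Bool) → Fm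
charFm L n v = bigAnd (Data.List.map (λ i → lit L (toℕ i) (v i)) (Data.List.allFin n))
  where import Data.List

-- a nonempty team on {p_0,…,p_{n-1}} is given by a nonempty list
-- enumerating its members (functions {p_0,…,p_{n-1}} → {0,1})
Θ : Logic → (n : ℕ) → List⁺ (Fin n → Bool) → Fm
Θ PD   n X = bigOp⁺ _⊗_ (L⁺.map (charFm PD n) X)
Θ InqL n X = negL InqL (negL InqL (bigOp⁺ _∨'_ (L⁺.map (charFm InqL n) X)))
Θ PT   n X = ¬' (¬' (bigOp⁺ _∨'_ (L⁺.map (charFm PT n) X)))

-- A relation E between valuations lifts to teams: X and X′ are related when every point of X has
-- an E-partner in X′ and vice versa.  If σ p on X matches p on X′ for all related teams, then
-- X ⊨ σψ iff X′ ⊨ ψ.  With σ the identity this gives locality and invariance of satisfaction; for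
-- a flat σ it says that X ⊨ σψ iff the image of X under σ̂ v = (p ↦ [{v} ⊨ σ p]) satisfies ψ.
-- (i)⇒(ii): Θ_X is flat.  (ii)⇒(i): take for X the restrictions of the valuations satisfying φ.
-- (ii)⇒(iii): fix v₀ ⊨ φ and let σ p be φ ∧ p if v₀ p = 0, and φ → p (¬φ ⊗ p in PD) otherwise;
-- σ̂ is the identity on valuations satisfying φ and constantly v₀ elsewhere, so it maps every team
-- into φ, whence ⊢ σφ.  (iii)⇒(ii): a projective σ makes σ̂ fix the valuations satisfying φ, so a
-- team whose points satisfy φ is its own image and ⊢ σφ yields X ⊨ φ.

module Submission where

open import Defs
open import Level using (Level; 0ℓ; lift; lower) renaming (suc to lsuc)
open import Axiom.ExcludedMiddle using (ExcludedMiddle)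
open import Data.Nat using (ℕ; zero; suc; _<_)
open import Data.Bool using (Bool; true; false)
open import Data.Bool.Properties using (⇔→≡; ¬-not; not-¬)
open import Data.Fin using (Fin; zero; suc; toℕ; fromℕ<)
open import Data.Fin.Properties using (toℕ-fromℕ<)
open import Data.List using (List; []; _∷_; _++_; map; filter)
open import Data.List.NonEmpty using (List⁺; _∷_; toList)
import Data.List.NonEmpty as List⁺
open import Data.List.Relation.Unary.All as All using (All; []; _∷_; lookupAny; universal)
import Data.List.Relation.Unary.All.Properties as All
open import Data.List.Relation.Unary.Any using (Any; here; there)
import Data.List.Relation.Unary.Any as Any
import Data.List.Relation.Unary.Any.Properties as Any
open import Data.Product using (Σ; ∃-syntax; _×_; _,_; proj₁; proj₂)
open import Data.Product.Function.NonDependent.Propositional using (_×-⇔_)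
open import Data.Sum using (_⊎_; inj₁; inj₂; [_,_])
import Data.Sum as Sum
open import Data.Sum.Function.Propositional using (_⊎-⇔_)
open import Data.Unit using (⊤; tt)
open import Data.Empty using (⊥; ⊥-elim)
open import Data.Vec.Functional using () renaming (_∷_ to _◂_)
open import Function using (_∘_; id; case_of_)
open import Function.Bundles using (_⇔_; mk⇔; Equivalence)
open import Function.Construct.Composition using (_⇔-∘_)
open import Function.Construct.Symmetry using (⇔-sym)
open import Function.Construct.Identity using (⇔-id)
open import Function.Properties.Inverse using (↔⇒⇔)
open import Function.Related.TypeIsomorphisms using (→-cong-⇔; ¬-cong-⇔)
open import Relation.Nullary using (¬_; Dec; does; yes; no)
open import Relation.Nullary.Decidable using (True; toWitness; fromWitness; does-⇔; decidable-stable)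
open import Relation.Binary.PropositionalEquality as ≡ using (_≡_; refl; sym; trans; cong; cong₂; _≗_)

open Equivalence using (to; from)

private
  variable
    ℓ ℓ′ : Level
    A : Set
    S : ℕ → Set
    E : Valuation → Valuation → Set
    X X′ Y Y′ : Team
    u v w : Valuation
    φ ψ : Fm
    p : ℕ

mutual
  VarsIn : (ℕ → Set) → Fm → Set
  VarsIn S (atom p)   = S p
  VarsIn S ⊥'         = ⊤
  VarsIn S ⊤'         = ⊤
  VarsIn S (dep φs ψ) = VarsInAll S φs × VarsIn S ψ
  VarsIn S (¬' φ)     = VarsIn S φ
  VarsIn S (φ ∧' ψ)   = VarsIn S φ × VarsIn S ψ
  VarsIn S (φ ⊗ ψ)    = VarsIn S φ × VarsIn S ψ
  VarsIn S (φ ∨' ψ)   = VarsIn S φ × VarsIn S ψ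
  VarsIn S (φ ⇒ ψ)    = VarsIn S φ × VarsIn S ψ

  VarsInAll : (ℕ → Set) → List Fm → Set
  VarsInAll S []       = ⊤
  VarsInAll S (φ ∷ φs) = VarsIn S φ × VarsInAll S φs

mutual
  VarsIn-⊤ : ∀ ψ → VarsIn (λ _ → ⊤) ψ
  VarsIn-⊤ (atom p)   = tt
  VarsIn-⊤ ⊥'         = tt
  VarsIn-⊤ ⊤'         = tt
  VarsIn-⊤ (dep φs ψ) = VarsInAll-⊤ φs , VarsIn-⊤ ψ
  VarsIn-⊤ (¬' φ)     = VarsIn-⊤ φ
  VarsIn-⊤ (φ ∧' ψ)   = VarsIn-⊤ φ , VarsIn-⊤ ψ
  VarsIn-⊤ (φ ⊗ ψ)    = VarsIn-⊤ φ , VarsIn-⊤ ψ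
  VarsIn-⊤ (φ ∨' ψ)   = VarsIn-⊤ φ , VarsIn-⊤ ψ
  VarsIn-⊤ (φ ⇒ ψ)    = VarsIn-⊤ φ , VarsIn-⊤ ψ

  VarsInAll-⊤ : ∀ φs → VarsInAll (λ _ → ⊤) φs
  VarsInAll-⊤ []       = tt
  VarsInAll-⊤ (φ ∷ φs) = VarsIn-⊤ φ , VarsInAll-⊤ φs

mutual
  VarsBelow⇒VarsIn : ∀ {n} ψ → VarsBelow n ψ → VarsIn (_< n) ψ
  VarsBelow⇒VarsIn (atom p)   h       = h
  VarsBelow⇒VarsIn ⊥'         _       = tt
  VarsBelow⇒VarsIn ⊤'         _       = tt
  VarsBelow⇒VarsIn (dep φs ψ) (a , b) = VarsBelowAll⇒VarsInAll φs a , VarsBelow⇒VarsIn ψ b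
  VarsBelow⇒VarsIn (¬' φ)     h       = VarsBelow⇒VarsIn φ h
  VarsBelow⇒VarsIn (φ ∧' ψ)   (a , b) = VarsBelow⇒VarsIn φ a , VarsBelow⇒VarsIn ψ b
  VarsBelow⇒VarsIn (φ ⊗ ψ)    (a , b) = VarsBelow⇒VarsIn φ a , VarsBelow⇒VarsIn ψ b
  VarsBelow⇒VarsIn (φ ∨' ψ)   (a , b) = VarsBelow⇒VarsIn φ a , VarsBelow⇒VarsIn ψ b
  VarsBelow⇒VarsIn (φ ⇒ ψ)    (a , b) = VarsBelow⇒VarsIn φ a , VarsBelow⇒VarsIn ψ b

  VarsBelowAll⇒VarsInAll : ∀ {n} φs → VarsBelowAll n φs → VarsInAll (_< n) φs
  VarsBelowAll⇒VarsInAll []       _       = tt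
  VarsBelowAll⇒VarsInAll (φ ∷ φs) (a , b) = VarsBelow⇒VarsIn φ a , VarsBelowAll⇒VarsInAll φs b

mutual
  subst-atom : ∀ ψ → subst atom ψ ≡ ψ
  subst-atom (atom p)   = refl
  subst-atom ⊥'         = refl
  subst-atom ⊤'         = refl
  subst-atom (dep φs ψ) = cong₂ dep (substs-atom φs) (subst-atom ψ)
  subst-atom (¬' φ)     = cong ¬' (subst-atom φ)
  subst-atom (φ ∧' ψ)   = cong₂ _∧'_ (subst-atom φ) (subst-atom ψ)
  subst-atom (φ ⊗ ψ)    = cong₂ _⊗_ (subst-atom φ) (subst-atom ψ)
  subst-atom (φ ∨' ψ)   = cong₂ _∨'_ (subst-atom φ) (subst-atom ψ)
  subst-atom (φ ⇒ ψ)    = cong₂ _⇒_ (subst-atom φ) (subst-atom ψ)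

  substs-atom : ∀ φs → substs atom φs ≡ φs
  substs-atom []       = refl
  substs-atom (φ ∷ φs) = cong₂ _∷_ (subst-atom φ) (substs-atom φs)

-- Transfer along related teams

Respects≗ : (Valuation → Valuation → Set) → Set
Respects≗ E = ∀ {u v w w′} → u ≗ v → w′ ≗ w → E v w → E u w′

EgliMilner : (Valuation → Valuation → Set) → Team → Team → Set
EgliMilner E X X′ = (∀ v → X v → ∃[ w ] X′ w × E v w)
                  × (∀ w → X′ w → ∃[ v ] X v × E v w)

Split : (Team → Set₁) → (Team → Set₁) → Team → Set₁
Split P Q X = Σ Team λ Y → Σ Team λ Z →
  Y ⊆ X × Z ⊆ X × (∀ v → X v → Y v ⊎ Z v) × P Y × Q Z

EgliMilner-map : ∀ {E′} → (∀ {v w} → E v w → E′ v w) → EgliMilner E X X′ → EgliMilner E′ X X′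
EgliMilner-map f (fwd , bwd) =
    (λ v xv → let w , x′w , e = fwd v xv in w , x′w , f e)
  , (λ w x′w → let v , xv , e = bwd w x′w in v , xv , f e)

EgliMilner-｛｝ : Respects≗ E → E v w → EgliMilner E ｛ v ｝ ｛ w ｝
EgliMilner-｛｝ resp e = (λ u u≗v → _ , (λ _ → refl) , resp u≗v (λ _ → refl) e)
                       , (λ w′ w′≗w → _ , (λ _ → refl) , resp (λ _ → refl) w′≗w e)

module _ {E : Valuation → Valuation → Set} where

  imageWithin : Team → Team → Team
  imageWithin X′ Y w = X′ w × ∃[ v ] Y v × E v w

  preimageWithin : Team → Team → Team
  preimageWithin X Y′ v = X v × ∃[ w ] Y′ w × E v w

  EgliMilner-imageWithin : Y ⊆ X → EgliMilner E X X′ → EgliMilner E Y (imageWithin X′ Y)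
  EgliMilner-imageWithin Y⊆X (fwd , _) =
      (λ v yv → let w , x′w , e = fwd v (Y⊆X v yv) in w , (x′w , v , yv , e) , e)
    , (λ w (_ , v , yv , e) → v , yv , e)

  EgliMilner-preimageWithin : Y′ ⊆ X′ → EgliMilner E X X′ → EgliMilner E (preimageWithin X Y′) Y′
  EgliMilner-preimageWithin Y′⊆X′ (_ , bwd) =
      (λ v (_ , w , y′w , e) → w , y′w , e)
    , (λ w y′w → let v , xv , e = bwd w (Y′⊆X′ w y′w) in v , (xv , w , y′w , e) , e)

  ∀∈-transfer : {P : Valuation → Set ℓ} {P′ : Valuation → Set ℓ′} →
    (∀ {v w} → E v w → P v ⇔ P′ w) →
    EgliMilner E X X′ → (∀ v → X v → P v) ⇔ (∀ w → X′ w → P′ w)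
  ∀∈-transfer P⇔P′ (fwd , bwd) = mk⇔
    (λ h w x′w → let v , xv , e = bwd w x′w in to (P⇔P′ e) (h v xv))
    (λ h v xv → let w , x′w , e = fwd v xv in from (P⇔P′ e) (h w x′w))

  ∀⊆-transfer : {P P′ : Team → Set₁} →
    (∀ {Y Y′} → EgliMilner E Y Y′ → P Y ⇔ P′ Y′) →
    EgliMilner E X X′ → (∀ Y → Y ⊆ X → P Y) ⇔ (∀ Y′ → Y′ ⊆ X′ → P′ Y′)
  ∀⊆-transfer P⇔P′ r = mk⇔
    (λ h Y′ Y′⊆X′ → to (P⇔P′ (EgliMilner-preimageWithin Y′⊆X′ r)) (h _ (λ _ → proj₁)))
    (λ h Y Y⊆X → from (P⇔P′ (EgliMilner-imageWithin Y⊆X r)) (h _ (λ _ → proj₁)))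

  Split-transfer : {P P′ Q Q′ : Team → Set₁} →
    (∀ {Y Y′} → EgliMilner E Y Y′ → P Y ⇔ P′ Y′) →
    (∀ {Y Y′} → EgliMilner E Y Y′ → Q Y ⇔ Q′ Y′) →
    EgliMilner E X X′ → Split P Q X ⇔ Split P′ Q′ X′
  Split-transfer {X = X} {X′} P⇔P′ Q⇔Q′ r@(fwd , bwd) = mk⇔
    (λ (Y , Z , Y⊆X , Z⊆X , cover , hY , hZ) →
        imageWithin X′ Y , imageWithin X′ Z , (λ _ → proj₁) , (λ _ → proj₁)
      , (λ w x′w → let v , xv , e = bwd w x′w in
           [ (λ yv → inj₁ (x′w , v , yv , e)) , (λ zv → inj₂ (x′w , v , zv , e)) ] (cover v xv))
      , to (P⇔P′ (EgliMilner-imageWithin Y⊆X r)) hY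
      , to (Q⇔Q′ (EgliMilner-imageWithin Z⊆X r)) hZ)
    (λ (Y′ , Z′ , Y′⊆X′ , Z′⊆X′ , cover , hY′ , hZ′) →
        preimageWithin X Y′ , preimageWithin X Z′ , (λ _ → proj₁) , (λ _ → proj₁)
      , (λ v xv → let w , x′w , e = fwd v xv in
           [ (λ y′w → inj₁ (xv , w , y′w , e)) , (λ z′w → inj₂ (xv , w , z′w , e)) ] (cover w x′w))
      , from (P⇔P′ (EgliMilner-preimageWithin Y′⊆X′ r)) hY′
      , from (Q⇔Q′ (EgliMilner-preimageWithin Z′⊆X′ r)) hZ′)

⊨atom⇔ : (X ⊨ atom p) ⇔ (∀ v → X v → v p ≡ true)
⊨atom⇔ = mk⇔ lower lift

⊨⊥⇔ : (X ⊨ ⊥') ⇔ (∀ v → ¬ X v)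
⊨⊥⇔ = mk⇔ lower lift

module Transfer (S : ℕ → Set) (σ : ℕ → Fm) (E-resp : Respects≗ E)
  (atom-transfer : ∀ {p X X′} → S p → EgliMilner E X X′ → (X ⊨ σ p) ⇔ (X′ ⊨ atom p)) where

  mutual
    ⊨-transfer : ∀ ψ → VarsIn S ψ → EgliMilner E X X′ → (X ⊨ subst σ ψ) ⇔ (X′ ⊨ ψ)
    ⊨-transfer (atom p) s r = atom-transfer s r
    ⊨-transfer ⊥' _ r = ⇔-sym ⊨⊥⇔ ⇔-∘ (∀∈-transfer (λ _ → ⇔-id ⊥) r ⇔-∘ ⊨⊥⇔)
    ⊨-transfer ⊤' _ _ = mk⇔ id id
    ⊨-transfer (dep φs ψ) (ss , s) = ∀⊆-transfer λ r →
      →-cong-⇔ (DepAnte-transfer φs ss r) (⊨-transfer ψ s r ⊎-⇔ NegSat-transfer ψ s r)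
    ⊨-transfer (¬' ψ) s = NegSat-transfer ψ s
    ⊨-transfer (φ ∧' ψ) (s , t) r = ⊨-transfer φ s r ×-⇔ ⊨-transfer ψ t r
    ⊨-transfer (φ ⊗ ψ) (s , t) = Split-transfer (⊨-transfer φ s) (⊨-transfer ψ t)
    ⊨-transfer (φ ∨' ψ) (s , t) r = ⊨-transfer φ s r ⊎-⇔ ⊨-transfer ψ t r
    ⊨-transfer (φ ⇒ ψ) (s , t) = ∀⊆-transfer λ r → →-cong-⇔ (⊨-transfer φ s r) (⊨-transfer ψ t r)

    NegSat-transfer : ∀ ψ → VarsIn S ψ → EgliMilner E X X′ → NegSat X (subst σ ψ) ⇔ NegSat X′ ψ
    NegSat-transfer ψ s = ∀∈-transfer λ e → ¬-cong-⇔ (⊨-transfer ψ s (EgliMilner-｛｝ E-resp e))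

    DepAnte-transfer : ∀ φs → VarsInAll S φs → EgliMilner E X X′ → DepAnte X (substs σ φs) ⇔ DepAnte X′ φs
    DepAnte-transfer []       _        _ = mk⇔ id id
    DepAnte-transfer (φ ∷ φs) (s , ss) r =
      (⊨-transfer φ s r ⊎-⇔ NegSat-transfer φ s r) ×-⇔ DepAnte-transfer φs ss r

Agree : (ℕ → Set) → Valuation → Valuation → Set
Agree S v w = ∀ i → S i → v i ≡ w i

Agree-respects≗ : Respects≗ (Agree S)
Agree-respects≗ u≗v w′≗w e i s = trans (u≗v i) (trans (e i s) (sym (w′≗w i)))

⊨-local : ∀ ψ → VarsIn S ψ → EgliMilner (Agree S) X X′ → X ⊨ ψ → X′ ⊨ ψ
⊨-local {S = S} {X = X} ψ s r h =
  to (⊨-transfer ψ s r) (≡.subst (X ⊨_) (sym (subst-atom ψ)) h)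
  where
  open Transfer S atom Agree-respects≗ (λ {p} s r →
    ⇔-sym ⊨atom⇔ ⇔-∘ (∀∈-transfer (λ e → mk⇔ (trans (sym (e p s))) (trans (e p s))) r ⇔-∘ ⊨atom⇔))

｛｝⊨-local : ∀ ψ → VarsIn S ψ → Agree S v w → ｛ v ｝ ⊨ ψ → ｛ w ｝ ⊨ ψ
｛｝⊨-local ψ s e = ⊨-local ψ s (EgliMilner-｛｝ Agree-respects≗ e)

⊨-invariant : ∀ ψ → EgliMilner _≗_ X X′ → X ⊨ ψ → X′ ⊨ ψ
⊨-invariant ψ r = ⊨-local ψ (VarsIn-⊤ ψ) (EgliMilner-map (λ e i _ → e i) r)

⊨-downward : ∀ ψ → Y ⊆ X → X ⊨ ψ → Y ⊨ ψ
⊨-downward (atom p)   Y⊆X (lift h) = lift λ v yv → h v (Y⊆X v yv)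
⊨-downward ⊥'         Y⊆X (lift h) = lift λ v yv → h v (Y⊆X v yv)
⊨-downward ⊤'         _   h        = h
⊨-downward (dep φs ψ) Y⊆X h        = λ Z Z⊆Y → h Z (λ v → Y⊆X v ∘ Z⊆Y v)
⊨-downward (¬' ψ)     Y⊆X h        = λ v → h v ∘ Y⊆X v
⊨-downward (φ ∧' ψ)   Y⊆X (a , b)  = ⊨-downward φ Y⊆X a , ⊨-downward ψ Y⊆X b
⊨-downward {Y = Y} (φ ⊗ ψ) Y⊆X (Z₁ , Z₂ , _ , _ , cover , a , b) =
    (λ v → Y v × Z₁ v) , (λ v → Y v × Z₂ v) , (λ _ → proj₁) , (λ _ → proj₁)
  , (λ v yv → Sum.map (yv ,_) (yv ,_) (cover v (Y⊆X v yv)))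
  , ⊨-downward φ (λ _ → proj₂) a , ⊨-downward ψ (λ _ → proj₂) b
⊨-downward (φ ∨' ψ)   Y⊆X          = Sum.map (⊨-downward φ Y⊆X) (⊨-downward ψ Y⊆X)
⊨-downward (φ ⇒ ψ)    Y⊆X h        = λ Z Z⊆Y → h Z (λ v → Y⊆X v ∘ Z⊆Y v)

⊨-empty : ∀ ψ → (∀ v → ¬ X v) → X ⊨ ψ
⊨-empty (atom p)   empty = lift λ v xv → ⊥-elim (empty v xv)
⊨-empty ⊥'         empty = lift empty
⊨-empty ⊤'         _     = lift tt
⊨-empty (dep φs ψ) empty = λ Y Y⊆X _ → inj₁ (⊨-empty ψ λ v → empty v ∘ Y⊆X v)
⊨-empty (¬' ψ)     empty = λ v xv → ⊥-elim (empty v xv)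
⊨-empty (φ ∧' ψ)   empty = ⊨-empty φ empty , ⊨-empty ψ empty
⊨-empty {X = X} (φ ⊗ ψ) empty =
  X , X , (λ _ → id) , (λ _ → id) , (λ _ → inj₁) , ⊨-empty φ empty , ⊨-empty ψ empty
⊨-empty (φ ∨' ψ)   empty = inj₁ (⊨-empty φ empty)
⊨-empty (φ ⇒ ψ)    empty = λ Y Y⊆X _ → ⊨-empty ψ λ v → empty v ∘ Y⊆X v

⊨-nonempty⊆｛｝ : ∀ ψ → Y ⊆ ｛ v ｝ → Y u → Y ⊨ ψ → ｛ v ｝ ⊨ ψ
⊨-nonempty⊆｛｝ {u = u} ψ Y⊆v yu = ⊨-invariant ψ
  ( (λ w yw → _ , (λ _ → refl) , Y⊆v w yw)
  , (λ w w≗v → u , yu , λ i → trans (Y⊆v u yu i) (sym (w≗v i))))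

⊨-point : ∀ ψ → X v → X ⊨ ψ → ｛ v ｝ ⊨ ψ
⊨-point ψ xv h = ⊨-nonempty⊆｛｝ ψ (λ _ → proj₂) (xv , λ _ → refl) (⊨-downward ψ (λ _ → proj₁) h)

｛｝⊨-≗ : ∀ ψ → v ≗ w → ｛ v ｝ ⊨ ψ → ｛ w ｝ ⊨ ψ
｛｝⊨-≗ ψ v≗w = ⊨-nonempty⊆｛｝ ψ (λ u u≗v i → trans (u≗v i) (v≗w i)) (λ _ → refl)

-- Flatness

mkFlat : ∀ φ → (∀ {X} → (∀ v → X v → ｛ v ｝ ⊨ φ) → X ⊨ φ) → Flat φ
mkFlat φ fromPoints X = (λ h v xv → ⊨-point φ xv h) , fromPoints

flat⇔ : Flat φ → (X ⊨ φ) ⇔ (∀ v → X v → ｛ v ｝ ⊨ φ)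
flat⇔ {X = X} flat = mk⇔ (proj₁ (flat X)) (proj₂ (flat X))

entailment-on-singletons : Flat ψ → (∀ {v} → ｛ v ｝ ⊨ φ → ｛ v ｝ ⊨ ψ) → X ⊨ φ → X ⊨ ψ
entailment-on-singletons {φ = φ} flat φ⇒ψ h = from (flat⇔ flat) λ v xv → φ⇒ψ (⊨-point φ xv h)

Flat-resp-equivalence : Flat ψ → (∀ {X} → X ⊨ φ → X ⊨ ψ) → (∀ {X} → X ⊨ ψ → X ⊨ φ) → Flat φ
Flat-resp-equivalence {φ = φ} flat φ⇒ψ ψ⇒φ = mkFlat φ λ h → ψ⇒φ (from (flat⇔ flat) λ v xv → φ⇒ψ (h v xv))

⊢-elim : ∀ {Γ L} → Γ ⊢⟨ L ⟩ ψ → All (X ⊨_) Γ → X ⊨ ψ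
⊢-elim (_ , _ , sound) = sound _

｛｝⊨atom⇔ : (｛ v ｝ ⊨ atom p) ⇔ (v p ≡ true)
｛｝⊨atom⇔ {p = p} = mk⇔ (λ (lift h) → h _ λ _ → refl) (λ e → lift λ w w≗v → trans (w≗v p) e)

atom-flat : Flat (atom p)
atom-flat {p = p} = mkFlat (atom p) λ h → lift λ v xv → to ｛｝⊨atom⇔ (h v xv)

｛｝⊭⊥ : ¬ (｛ v ｝ ⊨ ⊥')
｛｝⊭⊥ (lift h) = h _ λ _ → refl

⊥-flat : Flat ⊥'
⊥-flat = mkFlat ⊥' λ h → lift λ v xv → ｛｝⊭⊥ (h v xv)

⊤-flat : Flat ⊤'
⊤-flat = mkFlat ⊤' λ _ → lift tt

｛｝⊨¬⇔ : ∀ ψ → (｛ v ｝ ⊨ ¬' ψ) ⇔ (¬ (｛ v ｝ ⊨ ψ))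
｛｝⊨¬⇔ ψ = mk⇔ (λ h → h _ λ _ → refl) (λ ¬ψ w w≗v → ¬ψ ∘ ｛｝⊨-≗ ψ w≗v)

¬-flat : Flat (¬' ψ)
¬-flat {ψ = ψ} = mkFlat (¬' ψ) λ h v xv → to (｛｝⊨¬⇔ ψ) (h v xv)

∧-flat : Flat φ → Flat ψ → Flat (φ ∧' ψ)
∧-flat {φ = φ} {ψ = ψ} flatφ flatψ = mkFlat (φ ∧' ψ) λ h → from (flat⇔ flatφ) (λ v → proj₁ ∘ h v)
                                , from (flat⇔ flatψ) (λ v → proj₂ ∘ h v)

｛｝⊨⊗⇔ : ∀ φ ψ → (｛ v ｝ ⊨ φ ⊗ ψ) ⇔ ((｛ v ｝ ⊨ φ) ⊎ (｛ v ｝ ⊨ ψ))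
｛｝⊨⊗⇔ {v = v} φ ψ = mk⇔
  (λ (Y , Z , Y⊆v , Z⊆v , cover , hY , hZ) →
     [ (λ yv → inj₁ (⊨-nonempty⊆｛｝ φ Y⊆v yv hY)) , (λ zv → inj₂ (⊨-nonempty⊆｛｝ ψ Z⊆v zv hZ)) ]
       (cover v λ _ → refl))
  [ (λ hφ → ｛ v ｝ , ∅ , (λ _ → id) , (λ _ ()) , (λ _ → inj₁) , hφ , ⊨-empty ψ λ _ ())
  , (λ hψ → ∅ , ｛ v ｝ , (λ _ ()) , (λ _ → id) , (λ _ → inj₂) , ⊨-empty φ (λ _ ()) , hψ) ]
  where
  ∅ : Team
  ∅ _ = ⊥

-- Teams are Set-valued while satisfaction is Set₁-valued, so the two parts are carved out
-- by deciding satisfaction.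
⊗-flat : ExcludedMiddle (lsuc 0ℓ) → Flat φ → Flat ψ → Flat (φ ⊗ ψ)
⊗-flat {φ = φ} {ψ = ψ} em flatφ flatψ = mkFlat (φ ⊗ ψ) λ {X} h →
    (λ v → X v × True (em {｛ v ｝ ⊨ φ})) , (λ v → X v × True (em {｛ v ｝ ⊨ ψ}))
  , (λ _ → proj₁) , (λ _ → proj₁)
  , (λ v xv → Sum.map (λ hφ → xv , fromWitness {a? = em} hφ) (λ hψ → xv , fromWitness {a? = em} hψ)
                      (to (｛｝⊨⊗⇔ φ ψ) (h v xv)))
  , from (flat⇔ flatφ) (λ _ → toWitness {a? = em} ∘ proj₂)
  , from (flat⇔ flatψ) (λ _ → toWitness {a? = em} ∘ proj₂)

｛｝⊨⇒⇔ : Flat ψ → (｛ v ｝ ⊨ φ ⇒ ψ) ⇔ ((｛ v ｝ ⊨ φ) → (｛ v ｝ ⊨ ψ))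
｛｝⊨⇒⇔ {ψ = ψ} {φ = φ} flat = mk⇔
  (λ h → h _ λ _ → id)
  (λ f Y Y⊆v hY → from (flat⇔ flat) λ y yy →
     ｛｝⊨-≗ ψ (sym ∘ Y⊆v y yy) (f (｛｝⊨-≗ φ (Y⊆v y yy) (⊨-point φ yy hY))))

⇒-flat : Flat ψ → Flat (φ ⇒ ψ)
⇒-flat {ψ = ψ} {φ = φ} flat = mkFlat (φ ⇒ ψ) λ h Y Y⊆X hY →
  from (flat⇔ flat) λ y yy → to (｛｝⊨⇒⇔ flat) (h y (Y⊆X y yy)) (⊨-point φ yy hY)

｛｝⊨negL⇔ : ∀ L ψ → (｛ v ｝ ⊨ negL L ψ) ⇔ (¬ (｛ v ｝ ⊨ ψ))
｛｝⊨negL⇔ PD   ψ = ｛｝⊨¬⇔ ψ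
｛｝⊨negL⇔ InqL ψ = →-cong-⇔ (⇔-id _) (mk⇔ ｛｝⊭⊥ ⊥-elim) ⇔-∘ ｛｝⊨⇒⇔ {ψ = ⊥'} ⊥-flat
｛｝⊨negL⇔ PT   ψ = ｛｝⊨¬⇔ ψ

negL-flat : ∀ L ψ → Flat (negL L ψ)
negL-flat PD   ψ = ¬-flat {ψ = ψ}
negL-flat InqL ψ = ⇒-flat {ψ = ⊥'} {φ = ψ} ⊥-flat
negL-flat PT   ψ = ¬-flat {ψ = ψ}

｛｝⊨negL²⇔ : ExcludedMiddle (lsuc 0ℓ) → ∀ L ψ → (｛ v ｝ ⊨ negL L (negL L ψ)) ⇔ (｛ v ｝ ⊨ ψ)
｛｝⊨negL²⇔ em L ψ =
  mk⇔ (decidable-stable em) (λ h ¬h → ¬h h) ⇔-∘ (¬-cong-⇔ (｛｝⊨negL⇔ L ψ) ⇔-∘ ｛｝⊨negL⇔ L (negL L ψ))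

｛｝⊨lit⇔ : ∀ L p b → (｛ v ｝ ⊨ lit L p b) ⇔ (v p ≡ b)
｛｝⊨lit⇔ L p true  = ｛｝⊨atom⇔
｛｝⊨lit⇔ L p false = mk⇔ ¬-not not-¬ ⇔-∘ (¬-cong-⇔ ｛｝⊨atom⇔ ⇔-∘ ｛｝⊨negL⇔ L (atom p))

lit-flat : ∀ L p b → Flat (lit L p b)
lit-flat L p true  = atom-flat
lit-flat L p false = negL-flat L (atom p)

atom-∈L : ∀ L p → InL L (atom p)
atom-∈L PD   p = atom p
atom-∈L InqL p = lift (atom p)
atom-∈L PT   p = lift tt

lit-∈L : ∀ L p b → InL L (lit L p b)
lit-∈L L    p true  = atom-∈L L p
lit-∈L PD   p false = neg (atom p)
lit-∈L InqL p false = lift (imp (atom p) bot)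
lit-∈L PT   p false = lift tt

｛｝⊨bigAnd⇔ : ∀ φs → (｛ v ｝ ⊨ bigAnd φs) ⇔ All (｛ v ｝ ⊨_) φs
｛｝⊨bigAnd⇔ []           = mk⇔ (λ _ → []) (λ _ → lift tt)
｛｝⊨bigAnd⇔ (φ ∷ [])     = mk⇔ (_∷ []) All.head
｛｝⊨bigAnd⇔ (φ ∷ ψ ∷ φs) = mk⇔ (λ (h , hs) → h ∷ to (｛｝⊨bigAnd⇔ (ψ ∷ φs)) hs)
                                (λ hs → All.head hs , from (｛｝⊨bigAnd⇔ (ψ ∷ φs)) (All.tail hs))

bigAnd-closed : (P : Fm → Set ℓ) → P ⊤' → (∀ {φ ψ} → P φ → P ψ → P (φ ∧' ψ)) →
                ∀ {φs} → All P φs → P (bigAnd φs)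
bigAnd-closed P P⊤ P∧ []                 = P⊤
bigAnd-closed P P⊤ P∧ (h ∷ [])           = h
bigAnd-closed P P⊤ P∧ (h ∷ hs@(_ ∷ _))   = P∧ h (bigAnd-closed P P⊤ P∧ hs)

module _ (_∙_ : Fm → Fm → Fm) where

  bigOp⁺-closed : (P : Fm → Set ℓ) → (∀ {φ ψ} → P φ → P ψ → P (φ ∙ ψ)) →
                  ∀ φs → All P (toList φs) → P (bigOp⁺ _∙_ φs)
  bigOp⁺-closed P P∙ (φ ∷ φs) = closed φ φs
    where
    closed : ∀ φ φs → All P (φ ∷ φs) → P (bigOpFrom _∙_ φ φs)
    closed φ []       (h ∷ [])     = h
    closed φ (ψ ∷ φs) (h ∷ hs)     = P∙ h (closed ψ φs hs)

  ｛｝⊨bigOp⁺⇔ : (∀ {φ ψ} → (｛ v ｝ ⊨ φ ∙ ψ) ⇔ ((｛ v ｝ ⊨ φ) ⊎ (｛ v ｝ ⊨ ψ))) →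
                 ∀ φs → (｛ v ｝ ⊨ bigOp⁺ _∙_ φs) ⇔ Any (｛ v ｝ ⊨_) (toList φs)
  ｛｝⊨bigOp⁺⇔ {v = v} ∙⇔ (φ ∷ φs) = char φ φs
    where
    char : ∀ φ φs → (｛ v ｝ ⊨ bigOpFrom _∙_ φ φs) ⇔ Any (｛ v ｝ ⊨_) (φ ∷ φs)
    char φ []       = mk⇔ here λ { (here h) → h ; (there ()) }
    char φ (ψ ∷ φs) = ↔⇒⇔ (Any.∷↔ _) ⇔-∘ ((⇔-id _ ⊎-⇔ char ψ φs) ⇔-∘ ∙⇔)

Any-map-⇔ : {B : Set} {P : B → Set ℓ} {Q : A → Set ℓ′} (g : A → B) →
            (∀ {x} → P (g x) ⇔ Q x) → ∀ xs → Any P (map g xs) ⇔ Any Q xs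
Any-map-⇔ g P⇔Q xs = mk⇔ (Any.map (to P⇔Q) ∘ Any.map⁻) (Any.map⁺ ∘ Any.map (from P⇔Q))

-- Characteristic formulas

_extends_ : ∀ {n} → Valuation → (Fin n → Bool) → Set
v extends s = ∀ i → v (toℕ i) ≡ s i

｛｝⊨charFm⇔ : ∀ L n s → (｛ v ｝ ⊨ charFm L n s) ⇔ (v extends s)
｛｝⊨charFm⇔ L n s = mk⇔
  (λ h i → to (｛｝⊨lit⇔ L _ _) (All.tabulate⁻ (All.map⁻ (to (｛｝⊨bigAnd⇔ _) h)) i))
  (λ h → from (｛｝⊨bigAnd⇔ _) (All.map⁺ (All.tabulate⁺ λ i → from (｛｝⊨lit⇔ L _ _) (h i))))

charFm-flat : ∀ L n s → Flat (charFm L n s)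
charFm-flat L n s = bigAnd-closed Flat ⊤-flat ∧-flat (All.map⁺ (All.tabulate⁺ λ i → lit-flat L (toℕ i) (s i)))

charFm-∈L : ∀ L n s → InL L (charFm L n s)
charFm-∈L PD   n s = bigAnd-closed InPD top and (All.map⁺ (All.tabulate⁺ λ i → lit-∈L PD (toℕ i) (s i)))
charFm-∈L InqL n s =
  lift (bigAnd-closed InInqL top and (All.map⁺ (All.tabulate⁺ λ i → lower (lit-∈L InqL (toℕ i) (s i)))))
charFm-∈L PT   n s = lift tt

｛｝⊨¬¬⋁charFm⇔ : ExcludedMiddle (lsuc 0ℓ) → ∀ L n X →
  (｛ v ｝ ⊨ negL L (negL L (bigOp⁺ _∨'_ (List⁺.map (charFm L n) X)))) ⇔ Any (v extends_) (toList X)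
｛｝⊨¬¬⋁charFm⇔ em L n X@(_ ∷ _) =
  (Any-map-⇔ (charFm L n) (｛｝⊨charFm⇔ L n _) (toList X)
   ⇔-∘ ｛｝⊨bigOp⁺⇔ _∨'_ (⇔-id _) (List⁺.map (charFm L n) X))
  ⇔-∘ ｛｝⊨negL²⇔ em L _

｛｝⊨Θ⇔ : ExcludedMiddle (lsuc 0ℓ) → ∀ L n X → (｛ v ｝ ⊨ Θ L n X) ⇔ Any (v extends_) (toList X)
｛｝⊨Θ⇔ em PD n X@(_ ∷ _) =
  Any-map-⇔ (charFm PD n) (｛｝⊨charFm⇔ PD n _) (toList X)
  ⇔-∘ ｛｝⊨bigOp⁺⇔ _⊗_ (｛｝⊨⊗⇔ _ _) (List⁺.map (charFm PD n) X)
｛｝⊨Θ⇔ em InqL = ｛｝⊨¬¬⋁charFm⇔ em InqL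
｛｝⊨Θ⇔ em PT   = ｛｝⊨¬¬⋁charFm⇔ em PT

Θ-flat : ExcludedMiddle (lsuc 0ℓ) → ∀ L n X → Flat (Θ L n X)
Θ-flat em PD   n X@(_ ∷ _) =
  bigOp⁺-closed _⊗_ Flat (⊗-flat em) (List⁺.map (charFm PD n) X) (All.map⁺ (universal (charFm-flat PD n) (toList X)))
Θ-flat em InqL n X = negL-flat InqL (negL InqL (bigOp⁺ _∨'_ (List⁺.map (charFm InqL n) X)))
Θ-flat em PT   n X = negL-flat PT (negL PT (bigOp⁺ _∨'_ (List⁺.map (charFm PT n) X)))

Θ-∈L : ∀ L n X → InL L (Θ L n X)
Θ-∈L PD   n X@(_ ∷ _) =
  bigOp⁺-closed _⊗_ InPD tens (List⁺.map (charFm PD n) X) (All.map⁺ (universal (charFm-∈L PD n) (toList X)))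
Θ-∈L InqL n X@(_ ∷ _) = lift (imp (imp (bigOp⁺-closed _∨'_ InInqL or (List⁺.map (charFm InqL n) X)
  (All.map⁺ (universal (lower ∘ charFm-∈L InqL n) (toList X)))) bot) bot)
Θ-∈L PT   n X = lift tt

-- Flat substitutions

Dec⇔does≡true : {B : Set ℓ} (d : Dec B) → B ⇔ (does d ≡ true)
Dec⇔does≡true (yes b) = mk⇔ (λ _ → refl) (λ _ → b)
Dec⇔does≡true (no ¬b) = mk⇔ (⊥-elim ∘ ¬b) λ ()

subst-InInqL : ∀ {σ} → (∀ p → InInqL (σ p)) → InInqL ψ → InInqL (subst σ ψ)
subst-InInqL σ-∈ (atom p)  = σ-∈ p
subst-InInqL σ-∈ bot       = bot
subst-InInqL σ-∈ top       = top
subst-InInqL σ-∈ (and φ ψ) = and (subst-InInqL σ-∈ φ) (subst-InInqL σ-∈ ψ)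
subst-InInqL σ-∈ (or φ ψ)  = or (subst-InInqL σ-∈ φ) (subst-InInqL σ-∈ ψ)
subst-InInqL σ-∈ (imp φ ψ) = imp (subst-InInqL σ-∈ φ) (subst-InInqL σ-∈ ψ)

module FlatSubstitution (em : ExcludedMiddle (lsuc 0ℓ)) (σ : ℕ → Fm) (σ-flat : ∀ p → Flat (σ p)) where

  σ̂ : Valuation → Valuation
  σ̂ v p = does (em {｛ v ｝ ⊨ σ p})

  σ̂-spec : (｛ v ｝ ⊨ σ p) ⇔ (σ̂ v p ≡ true)
  σ̂-spec = Dec⇔does≡true em

  σ̂-resp-≗ : u ≗ v → σ̂ u ≗ σ̂ v
  σ̂-resp-≗ u≗v p = does-⇔ (mk⇔ (｛｝⊨-≗ (σ p) u≗v) (｛｝⊨-≗ (σ p) (sym ∘ u≗v))) em em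

  Graph : Valuation → Valuation → Set
  Graph v w = w ≗ σ̂ v

  Graph-respects≗ : Respects≗ Graph
  Graph-respects≗ u≗v w′≗w w≗σ̂v i = trans (w′≗w i) (trans (w≗σ̂v i) (σ̂-resp-≗ (sym ∘ u≗v) i))

  open Transfer (λ _ → ⊤) σ Graph-respects≗ (λ {p} _ r →
    ⇔-sym ⊨atom⇔ ⇔-∘ (∀∈-transfer (λ w≗σ̂v → mk⇔ (trans (w≗σ̂v p)) (trans (sym (w≗σ̂v p))) ⇔-∘ σ̂-spec) r
                       ⇔-∘ flat⇔ (σ-flat p)))

  image : Team → Team
  image X w = ∃[ v ] X v × w ≗ σ̂ v

  ⊨subst⇔⊨image : ∀ ψ → (X ⊨ subst σ ψ) ⇔ (image X ⊨ ψ)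
  ⊨subst⇔⊨image ψ = ⊨-transfer ψ (VarsIn-⊤ ψ)
    ((λ v xv → σ̂ v , (v , xv , λ _ → refl) , λ _ → refl) , (λ w (v , xv , w≗σ̂v) → v , xv , w≗σ̂v))

  ｛｝⊨subst⇔ : ∀ ψ → (｛ v ｝ ⊨ subst σ ψ) ⇔ (｛ σ̂ v ｝ ⊨ ψ)
  ｛｝⊨subst⇔ ψ = ⊨-transfer ψ (VarsIn-⊤ ψ) (EgliMilner-｛｝ Graph-respects≗ λ _ → refl)

  subst-flat : ∀ ψ → Flat ψ → Flat (subst σ ψ)
  subst-flat ψ flat = mkFlat (subst σ ψ) λ h → from (⊨subst⇔⊨image ψ) (from (flat⇔ flat)
    λ w (v , xv , w≗σ̂v) → ｛｝⊨-≗ ψ (sym ∘ w≗σ̂v) (to (｛｝⊨subst⇔ ψ) (h v xv)))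

  mutual
    subst-InPD : (∀ p → InPD (σ p)) → InPD ψ → InPD (subst σ ψ)
    subst-InPD σ-∈ (atom p)           = σ-∈ p
    subst-InPD σ-∈ bot                = bot
    subst-InPD σ-∈ top                = top
    subst-InPD σ-∈ (dep {β = β} αs β-∈ β-flat) =
      dep (subst-InPDFlats σ-∈ αs) (subst-InPD σ-∈ β-∈) (subst-flat β β-flat)
    subst-InPD σ-∈ (neg φ)            = neg (subst-InPD σ-∈ φ)
    subst-InPD σ-∈ (and φ ψ)          = and (subst-InPD σ-∈ φ) (subst-InPD σ-∈ ψ)
    subst-InPD σ-∈ (tens φ ψ)         = tens (subst-InPD σ-∈ φ) (subst-InPD σ-∈ ψ)

    subst-InPDFlats : ∀ {αs} → (∀ p → InPD (σ p)) → InPDFlats αs → InPDFlats (substs σ αs)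
    subst-InPDFlats σ-∈ []                                = []
    subst-InPDFlats σ-∈ (_∷_ {α = α} (α-∈ , α-flat) αs) =
      (subst-InPD σ-∈ α-∈ , subst-flat α α-flat) ∷ subst-InPDFlats σ-∈ αs

  subst-∈L : ∀ L → (∀ p → InL L (σ p)) → InL L ψ → InL L (subst σ ψ)
  subst-∈L PD   σ-∈ ψ-∈        = subst-InPD σ-∈ ψ-∈
  subst-∈L InqL σ-∈ (lift ψ-∈) = lift (subst-InInqL (lower ∘ σ-∈) ψ-∈)
  subst-∈L PT   _   _          = lift tt

FProjective⇒Flat : ExcludedMiddle (lsuc 0ℓ) → ∀ L φ → FProjective L φ → Flat φ
FProjective⇒Flat em L φ (σ , σ-admissible , ⊢σφ , σ-projects) = mkFlat φ λ {X} h →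
  ⊨-invariant φ (image≗ h) (to (⊨subst⇔⊨image φ) (⊢-elim ⊢σφ []))
  where
  open FlatSubstitution em σ (proj₂ ∘ σ-admissible)

  σ̂-fixes-φ : ｛ v ｝ ⊨ φ → σ̂ v ≗ v
  σ̂-fixes-φ hv p = ⇔→≡ (mk⇔
    (λ e → to ｛｝⊨atom⇔ (⊢-elim (proj₁ (σ-projects p)) (hv ∷ from σ̂-spec e ∷ [])))
    (λ e → to σ̂-spec (⊢-elim (proj₂ (σ-projects p)) (hv ∷ from ｛｝⊨atom⇔ e ∷ []))))

  image≗ : (∀ v → X v → ｛ v ｝ ⊨ φ) → EgliMilner _≗_ (image X) X
  image≗ h = (λ w (v , xv , w≗σ̂v) → v , xv , λ i → trans (w≗σ̂v i) (σ̂-fixes-φ (h v xv) i))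
           , (λ v xv → σ̂ v , (v , xv , λ _ → refl) , σ̂-fixes-φ (h v xv))

-- Flat formulas are projective

projector : Logic → Fm → Bool → ℕ → Fm
projector L    φ false p = φ ∧' atom p
projector PD   φ true  p = ¬' φ ⊗ atom p
projector InqL φ true  p = φ ⇒ atom p
projector PT   φ true  p = φ ⇒ atom p

module _ (em : ExcludedMiddle (lsuc 0ℓ)) where

  ｛｝⊨projector-true⇔ : ∀ L → (｛ v ｝ ⊨ projector L φ true p) ⇔ ((｛ v ｝ ⊨ φ) → v p ≡ true)
  ｛｝⊨projector-true⇔ {v = v} {φ = φ} {p = p} PD = mk⇔
    (λ h hv → [ (λ ¬φ → ⊥-elim (to (｛｝⊨¬⇔ φ) ¬φ hv)) , to ｛｝⊨atom⇔ ] (to (｛｝⊨⊗⇔ (¬' φ) (atom p)) h))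
    (λ f → from (｛｝⊨⊗⇔ (¬' φ) (atom p)) (case em {｛ v ｝ ⊨ φ} of λ where
      (yes hv) → inj₂ (from ｛｝⊨atom⇔ (f hv))
      (no ¬hv) → inj₁ (from (｛｝⊨¬⇔ φ) ¬hv)))
  ｛｝⊨projector-true⇔ {p = p} InqL = →-cong-⇔ (⇔-id _) ｛｝⊨atom⇔ ⇔-∘ ｛｝⊨⇒⇔ {ψ = atom p} atom-flat
  ｛｝⊨projector-true⇔ {p = p} PT   = →-cong-⇔ (⇔-id _) ｛｝⊨atom⇔ ⇔-∘ ｛｝⊨⇒⇔ {ψ = atom p} atom-flat

  projector-on : ∀ L b p → ｛ v ｝ ⊨ φ → (｛ v ｝ ⊨ projector L φ b p) ⇔ (v p ≡ true)
  projector-on L false p hv = mk⇔ (to ｛｝⊨atom⇔ ∘ proj₂) (λ e → hv , from ｛｝⊨atom⇔ e)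
  projector-on L true  p hv = mk⇔ (λ f → f hv) (λ e _ → e) ⇔-∘ ｛｝⊨projector-true⇔ L

  projector-off : ∀ L b p → ¬ (｛ v ｝ ⊨ φ) → (｛ v ｝ ⊨ projector L φ b p) ⇔ (b ≡ true)
  projector-off L false p ¬hv = mk⇔ (⊥-elim ∘ ¬hv ∘ proj₁) λ ()
  projector-off L true  p ¬hv = mk⇔ (λ _ → refl) (λ _ → ⊥-elim ∘ ¬hv) ⇔-∘ ｛｝⊨projector-true⇔ L

  projector-flat : ∀ L b p → Flat φ → Flat (projector L φ b p)
  projector-flat L    false p φ-flat = ∧-flat {ψ = atom p} φ-flat atom-flat
  projector-flat {φ = φ} PD true p _ = ⊗-flat {φ = ¬' φ} {ψ = atom p} em (¬-flat {ψ = φ}) atom-flat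
  projector-flat InqL true  p _      = ⇒-flat {ψ = atom p} atom-flat
  projector-flat PT   true  p _      = ⇒-flat {ψ = atom p} atom-flat

projector-∈L : ∀ L b p → InL L φ → InL L (projector L φ b p)
projector-∈L PD   false p φ-∈        = and φ-∈ (atom p)
projector-∈L PD   true  p φ-∈        = tens (neg φ-∈) (atom p)
projector-∈L InqL false p (lift φ-∈) = lift (and φ-∈ (atom p))
projector-∈L InqL true  p (lift φ-∈) = lift (imp φ-∈ (atom p))
projector-∈L PT   b     p _          = lift tt

Flat⇒FProjective : ExcludedMiddle (lsuc 0ℓ) → ∀ L {v₀} → InL L φ → Flat φ → ｛ v₀ ｝ ⊨ φ → FProjective L φ
Flat⇒FProjective {φ = φ} em L {v₀} φ-∈ φ-flat hv₀ =
    σ , (λ p → σ-∈ p , σ-flat p)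
  , ([] , subst-∈L L σ-∈ φ-∈ , λ _ _ → from (flat⇔ (subst-flat φ φ-flat)) λ v _ → from (｛｝⊨subst⇔ φ) (σ̂-into-φ v))
  , λ p → (φ-∈ ∷ σ-∈ p ∷ [] , atom-∈L L p , λ { _ (hφ ∷ hσ ∷ []) → φ,σ⊨p p hφ hσ })
        , (φ-∈ ∷ atom-∈L L p ∷ [] , σ-∈ p , λ { _ (hφ ∷ hp ∷ []) → φ,p⊨σ p hφ hp })
  where
  σ : ℕ → Fm
  σ p = projector L φ (v₀ p) p

  σ-flat : ∀ p → Flat (σ p)
  σ-flat p = projector-flat em L (v₀ p) p φ-flat

  σ-∈ : ∀ p → InL L (σ p)
  σ-∈ p = projector-∈L L (v₀ p) p φ-∈

  open FlatSubstitution em σ σ-flat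

  σ̂-into-φ : ∀ v → ｛ σ̂ v ｝ ⊨ φ
  σ̂-into-φ v with em {｛ v ｝ ⊨ φ}
  ... | yes hv = ｛｝⊨-≗ φ (λ p → sym (⇔→≡ (projector-on em L (v₀ p) p hv ⇔-∘ ⇔-sym σ̂-spec))) hv
  ... | no ¬hv = ｛｝⊨-≗ φ (λ p → sym (⇔→≡ (projector-off em L (v₀ p) p ¬hv ⇔-∘ ⇔-sym σ̂-spec))) hv₀

  φ,σ⊨p : ∀ p → Y ⊨ φ → Y ⊨ σ p → Y ⊨ atom p
  φ,σ⊨p p hφ hσ = from ⊨atom⇔ λ y yy →
    to (projector-on em L (v₀ p) p (⊨-point φ yy hφ)) (⊨-point (σ p) yy hσ)

  φ,p⊨σ : ∀ p → Y ⊨ φ → Y ⊨ atom p → Y ⊨ σ p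
  φ,p⊨σ p hφ hp = from (flat⇔ (σ-flat p)) λ y yy →
    from (projector-on em L (v₀ p) p (⊨-point φ yy hφ)) (to ｛｝⊨atom⇔ (⊨-point (atom p) yy hp))

-- Flat formulas are characteristic formulas

allAssignments : ∀ n → List (Fin n → Bool)
allAssignments zero    = (λ ()) ∷ []
allAssignments (suc n) = map (true ◂_) (allAssignments n) ++ map (false ◂_) (allAssignments n)

extends-◂ : ∀ {n b} {s : Fin n → Bool} → v 0 ≡ b → (v ∘ suc) extends s → v extends (b ◂ s)
extends-◂ v0≡b _   zero    = v0≡b
extends-◂ _    ext (suc i) = ext i

allAssignments-complete : ∀ n v → Any (v extends_) (allAssignments n)
allAssignments-complete zero    v = here λ ()
allAssignments-complete (suc n) v with v 0 in v0≡
... | true  = Any.++⁺ˡ (Any.map⁺ (Any.map (extends-◂ {v = v} v0≡) (allAssignments-complete n (v ∘ suc))))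
... | false = Any.++⁺ʳ _ (Any.map⁺ (Any.map (extends-◂ {v = v} v0≡) (allAssignments-complete n (v ∘ suc))))

extends-agree : ∀ {n} {s : Fin n → Bool} → v extends s → w extends s → Agree (_< n) v w
extends-agree {v = v} {w = w} v-ext w-ext i i<n =
  ≡.subst (λ k → v k ≡ w k) (toℕ-fromℕ< i<n) (trans (v-ext (fromℕ< i<n)) (sym (w-ext (fromℕ< i<n))))

fromAny : {P : A → Set ℓ} (xs : List A) → Any P xs → List⁺ A
fromAny (x ∷ xs) _ = x ∷ xs

Any-fromAny⇔ : {P : A → Set ℓ} {Q : A → Set ℓ′} (xs : List A) (a : Any P xs) →
               Any Q (toList (fromAny xs a)) ⇔ Any Q xs
Any-fromAny⇔ (x ∷ xs) _ = ⇔-id _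

module NormalForm (em : ExcludedMiddle (lsuc 0ℓ)) {n φ} (φ-vars : VarsBelow n φ) where

  Realised : (Fin n → Bool) → Set₁
  Realised s = ∃[ w ] (｛ w ｝ ⊨ φ) × w extends s

  realised : List (Fin n → Bool)
  realised = filter (λ s → em {Realised s}) (allAssignments n)

  ｛｝⊨⇔realised : (｛ v ｝ ⊨ φ) ⇔ Any (v extends_) realised
  ｛｝⊨⇔realised {v = v} = mk⇔
    (λ hv → Sum.[ id , (λ ¬realised → ⊥-elim (¬realised (v , hv , Any.lookup-result complete))) ]′
              (Any.filter⁺ (λ s → em {Realised s}) complete))
    (λ a → let (w , hw , w-ext) , v-ext = lookupAny (All.all-filter (λ s → em {Realised s}) (allAssignments n)) a in
       ｛｝⊨-local φ (VarsBelow⇒VarsIn φ φ-vars) (extends-agree w-ext v-ext) hw)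
    where complete = allAssignments-complete n v

Flat⇒Θ : ExcludedMiddle (lsuc 0ℓ) → ∀ L {n v₀} → InL L φ → VarsBelow n φ → Flat φ → ｛ v₀ ｝ ⊨ φ →
         Σ (List⁺ (Fin n → Bool)) λ X → ((φ ∷ []) ⊢⟨ L ⟩ Θ L n X) × ((Θ L n X ∷ []) ⊢⟨ L ⟩ φ)
Flat⇒Θ {φ = φ} em L {n} φ-∈ φ-vars φ-flat hv₀ =
    Xφ
  , (φ-∈ ∷ [] , Θ-∈L L n Xφ , λ { _ (h ∷ []) → entailment-on-singletons (Θ-flat em L n Xφ) (to ｛｝⊨φ⇔Θ) h })
  , (Θ-∈L L n Xφ ∷ [] , φ-∈ , λ { _ (h ∷ []) → entailment-on-singletons φ-flat (from ｛｝⊨φ⇔Θ) h })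
  where
  open NormalForm em {n} {φ} φ-vars

  Xφ : List⁺ (Fin n → Bool)
  Xφ = fromAny realised (to ｛｝⊨⇔realised hv₀)

  ｛｝⊨φ⇔Θ : (｛ v ｝ ⊨ φ) ⇔ (｛ v ｝ ⊨ Θ L n Xφ)
  ｛｝⊨φ⇔Θ = ⇔-sym (｛｝⊨Θ⇔ em L n Xφ) ⇔-∘ (⇔-sym (Any-fromAny⇔ realised _) ⇔-∘ ｛｝⊨⇔realised)

lemma4p6 : ExcludedMiddle (lsuc 0ℓ) →
    (L : Logic) (n : ℕ) (φ : Fm) →
    InL L φ → VarsBelow n φ → Consistent φ →
      (((Σ (List⁺ (Fin n → Bool)) λ X →
            ((φ ∷ []) ⊢⟨ L ⟩ Θ L n X) × ((Θ L n X ∷ []) ⊢⟨ L ⟩ φ)) → Flat φ)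
       × (Flat φ → (Σ (List⁺ (Fin n → Bool)) λ X →
            ((φ ∷ []) ⊢⟨ L ⟩ Θ L n X) × ((Θ L n X ∷ []) ⊢⟨ L ⟩ φ))))
    × ((Flat φ → FProjective L φ) × (FProjective L φ → Flat φ))
lemma4p6 em L n φ φ-∈ φ-vars (_ , (v₀ , x₀) , h) =
    ( (λ (X , φ⊢Θ , Θ⊢φ) →
         Flat-resp-equivalence (Θ-flat em L n X) (λ hφ → ⊢-elim φ⊢Θ (hφ ∷ [])) (λ hΘ → ⊢-elim Θ⊢φ (hΘ ∷ [])))
    , (λ φ-flat → Flat⇒Θ em L φ-∈ φ-vars φ-flat hv₀))
  , ( (λ φ-flat → Flat⇒FProjective em L φ-∈ φ-flat hv₀)
    , FProjective⇒Flat em L φ)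
  where
  hv₀ : ｛ v₀ ｝ ⊨ φ
  hv₀ = ⊨-point φ x₀ h
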